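{- Let $n\ge1$, $C\in DC(n)$, $j\in[n]$ and $k\ge0$ with $h(j)=2k$. If the $j$-th column of $C$ contains two odd dots, then there exists $j'<j$ such that $h(j'+1)=2k$ and the $j'$-th column of $C$ contains two even dots.
   Context: A Dellac configuration of size $n$ is a placement of $2n$ dots in a grid with $n$ columns (indexed $1..n$ left to right) and $2n$ rows (indexed $1..2n$ bottom to top) such that each row has exactly one dot, each column exactly two dots, and each dot in column $j$, row $i$ satisfies $j\le i\le j+n$; $DC(n)$ is their set. A dot is called even if it lies in a row $i\le n$ (its label $e_i=2i+2$ is even) and odd if it lies in a row $n+i$, $i\in[n]$ (its label $e_{n+i}=2i-1$ is odd). For $j\in[n]$, the height $h(j)$ is $n_e(j)-n_o(j)$, where $n_e(j)$ (resp. $n_o(j)$) is the number of even (resp. odd) dots in the first $j-1$ columns of $C$ (so $h(1)=0$). -}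

module Defs where

open import Data.Nat using (ℕ; suc; _+_; _*_; _≤_; _<_; _<?_; _≤?_)
open import Data.Fin using (Fin; toℕ)
import Data.Fin as Fin
open import Data.List using (List; length; filter; allFin)
open import Data.Integer using (ℤ; +_; _-_)
open import Data.Product using (_×_)
open import Relation.Nullary.Decidable using (_×-dec_)
open import Relation.Binary.PropositionalEquality using (_≡_)

-- Conventions (0-indexed): a row r : Fin (2 * n) stands for row i = toℕ r + 1,
-- a column c : Fin n stands for column j = toℕ c + 1.
-- Since every row contains exactly one dot, a placement of dots with one dot
-- per row is the map sending each row to the column of its dot.
record DC (n : ℕ) : Set where
  field
    col    : Fin (2 * n) → Fin n
    two    : ∀ (c : Fin n) →
             length (filter (λ r → col r Fin.≟ c) (allFin (2 * n))) ≡ 2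
    -- j ≤ i ≤ j + n, i.e. (toℕ c + 1) ≤ (toℕ r + 1) ≤ (toℕ c + 1) + n
    bounds : ∀ (r : Fin (2 * n)) → toℕ (col r) ≤ toℕ r × toℕ r ≤ toℕ (col r) + n

open DC public

-- even dot: in row i ≤ n (i.e. toℕ r < n); odd dot: in row n + i (toℕ r ≥ n).

evenInCol : ∀ {n} → DC n → Fin n → ℕ
evenInCol {n} C c =
  length (filter (λ r → (col C r Fin.≟ c) ×-dec (suc (toℕ r) ≤? n)) (allFin (2 * n)))

oddInCol : ∀ {n} → DC n → Fin n → ℕ
oddInCol {n} C c =
  length (filter (λ r → (col C r Fin.≟ c) ×-dec (n ≤? toℕ r)) (allFin (2 * n)))

nEven : ∀ {n} → DC n → ℕ → ℕ
nEven {n} C m =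
  length (filter (λ r → (suc (toℕ (col C r)) ≤? m) ×-dec (suc (toℕ r) ≤? n)) (allFin (2 * n)))

nOdd : ∀ {n} → DC n → ℕ → ℕ
nOdd {n} C m =
  length (filter (λ r → (suc (toℕ (col C r)) ≤? m) ×-dec (n ≤? toℕ r)) (allFin (2 * n)))

-- heightAfter C m = n_e - n_o over the first m columns, so that for the
-- (1-indexed) column j we have h(j) = heightAfter C (j - 1).
heightAfter : ∀ {n} → DC n → ℕ → ℤ
heightAfter C m = + nEven C m - + nOdd C m

h : ∀ {n} → DC n → Fin n → ℤ
h C c = heightAfter C (toℕ c)

module Submission where

-- Let e(m) and o(m) be the numbers of even and odd dots in the first m
-- columns, so that the height before column m + 1 is e(m) - o(m).
-- Since every column holds two dots, e(m) + o(m) = 2m; hence a height of 2k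
-- before column m + 1 means exactly e(m) = m + k.  The dots of rows 1, ..., m
-- are even and lie in the first m columns, so e(m) ≥ m, while e(0) = 0.
--
-- Now let column j (0-indexed J) carry two odd dots and have height 2k.
-- Then e(J) = J + k and e(J + 1) = e(J), so J + 1 ≤ J + k and k ≥ 1.  The
-- property "m + k ≤ e(m)" fails at m = 0 and holds at m = J, so it has a
-- first crossing i < J: e(i) < i + k but i + 1 + k ≤ e(i + 1).  Column i adds
-- at most two even dots to e, so it adds exactly two and e(i + 1) = (i + 1) + k,
-- i.e. column i has two even dots and the height after it is 2k.

open import Defs
open import Data.Nat
open import Data.Nat.Properties
open import Data.Fin using (Fin; toℕ; fromℕ<) renaming (suc to fsuc)
import Data.Fin as Fin
open import Data.Fin.Properties using (toℕ-injective; toℕ<n; toℕ-fromℕ<)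
open import Data.Integer using (+_; _⊖_) renaming (_-_ to _-ℤ_)
open import Data.Integer.Properties
  using ([+m]-[+n]≡m⊖n; [1+m]⊖[1+n]≡m⊖n; +-cancelˡ-⊖; ⊖-≥) renaming (+-injective to pos-injective)
open import Data.List using (List; []; _∷_; length; filter; map; tabulate; allFin)
open import Data.List.Properties using (map-tabulate; filter-none)
open import Data.List.Relation.Unary.All using (universal)
open import Data.Product using (Σ; _×_; _,_; proj₁; proj₂)
open import Data.Sum using (_⊎_; inj₁; inj₂; [_,_]′) renaming (map to ⊎-map)
open import Data.Empty using (⊥-elim)
open import Relation.Nullary using (¬_; yes; no; contradiction)
open import Relation.Nullary.Decidable using (_×-dec_)
open import Relation.Unary using (Pred; Decidable)
open import Relation.Binary.PropositionalEquality hiding (J)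
open import Level using (Level)

private
  variable
    a b p q r : Level
    A : Set a
    B : Set b

count : ∀ {P : Pred A p} → Decidable P → List A → ℕ
count P? xs = length (filter P? xs)

count-split : ∀ {P : Pred A p} {Q : Pred A q} {R : Pred A r}
  (P? : Decidable P) (Q? : Decidable Q) (R? : Decidable R) →
  (∀ x → P x → Q x ⊎ R x) → (∀ x → Q x → P x) → (∀ x → R x → P x) →
  (∀ x → Q x → ¬ R x) →
  ∀ xs → count P? xs ≡ count Q? xs + count R? xs
count-split P? Q? R? P⇒Q⊎R Q⇒P R⇒P Q⇒¬R [] = refl
count-split P? Q? R? P⇒Q⊎R Q⇒P R⇒P Q⇒¬R (x ∷ xs)
  with ih ← count-split P? Q? R? P⇒Q⊎R Q⇒P R⇒P Q⇒¬R xs | P? x | Q? x | R? x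
... | yes _ | yes q | yes r = contradiction r (Q⇒¬R x q)
... | yes _ | yes _ | no _  = cong suc ih
... | yes _ | no _  | yes _ = trans (cong suc ih) (sym (+-suc _ _))
... | yes p | no ¬q | no ¬r = ⊥-elim ([ ¬q , ¬r ]′ (P⇒Q⊎R x p))
... | no ¬p | yes q | _     = contradiction (Q⇒P x q) ¬p
... | no ¬p | no _  | yes r = contradiction (R⇒P x r) ¬p
... | no _  | no _  | no _  = ih

count-mono : ∀ {P : Pred A p} {Q : Pred A q} (P? : Decidable P) (Q? : Decidable Q) →
  (∀ x → Q x → P x) → ∀ xs → count Q? xs ≤ count P? xs
count-mono P? Q? Q⇒P [] = z≤n
count-mono P? Q? Q⇒P (x ∷ xs) with ih ← count-mono P? Q? Q⇒P xs | P? x | Q? x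
... | yes _ | yes _ = s≤s ih
... | yes _ | no _  = m≤n⇒m≤1+n ih
... | no ¬p | yes q = contradiction (Q⇒P x q) ¬p
... | no _  | no _  = ih

count-map : ∀ {P : Pred B p} (P? : Decidable P) (f : A → B) xs →
  count P? (map f xs) ≡ count (λ x → P? (f x)) xs
count-map P? f [] = refl
count-map P? f (x ∷ xs) with P? (f x)
... | yes _ = cong suc (count-map P? f xs)
... | no _  = count-map P? f xs

count-none : ∀ {P : Pred A p} (P? : Decidable P) → (∀ x → ¬ P x) → ∀ xs → count P? xs ≡ 0
count-none P? nowhere xs = cong length (filter-none P? (universal nowhere xs))

count-below : ∀ N m → m ≤ N → count (λ (i : Fin N) → suc (toℕ i) ≤? m) (allFin N) ≡ m
count-below zero    zero    z≤n       = refl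
count-below (suc N) zero    _         = count-none (λ (i : Fin (suc N)) → suc (toℕ i) ≤? 0) (λ _ ()) (allFin (suc N))
count-below (suc N) (suc m) (s≤s m≤N) with 1 ≤? suc m
... | no 1≰1+m = contradiction (s≤s z≤n) 1≰1+m
... | yes _    = cong suc (begin
    count (λ i → suc (toℕ i) ≤? suc m) (tabulate {n = N} fsuc)
      ≡⟨ cong (count (λ i → suc (toℕ i) ≤? suc m)) (sym (map-tabulate {n = N} (λ i → i) fsuc)) ⟩
    count (λ i → suc (toℕ i) ≤? suc m) (map fsuc (allFin N))
      ≡⟨ count-map _ fsuc (allFin N) ⟩
    count (λ i → suc (toℕ (fsuc i)) ≤? suc m) (allFin N)
      ≡⟨ ≤-antisym (count-mono _ _ (λ _ → s≤s⁻¹) (allFin N))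
                   (count-mono _ _ (λ _ → s≤s) (allFin N)) ⟩
    count (λ i → suc (toℕ i) ≤? m) (allFin N)
      ≡⟨ count-below N m m≤N ⟩
    m ∎)
  where open ≡-Reasoning

first-crossing : ∀ {P : Pred ℕ p} → Decidable P → ∀ j → ¬ P 0 → P j →
  Σ ℕ λ i → i < j × ¬ P i × P (suc i)
first-crossing P? zero    ¬P0 P0 = contradiction P0 ¬P0
first-crossing P? (suc j) ¬P0 Pj+1 with P? j
... | no ¬Pj = j , n<1+n j , ¬Pj , Pj+1
... | yes Pj with first-crossing P? j ¬P0 Pj
...   | i , i<j , ¬Pi , Pi+1 = i , m<n⇒m<1+n i<j , ¬Pi , Pi+1

jump-by-two : ∀ {a b x} → a < b → b < a + x → x ≤ 2 → x ≡ 2 × a + x ≡ suc b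
jump-by-two {a} {b} {x} a<b b<a+x x≤2 = x≡2 , ≤-antisym a+x≤1+b b<a+x
  where
    open ≤-Reasoning
    a+x≤1+b : a + x ≤ suc b
    a+x≤1+b = begin
      a + x ≤⟨ +-monoʳ-≤ a x≤2 ⟩
      a + 2 ≡⟨ +-comm a 2 ⟩
      suc (suc a) ≤⟨ s≤s a<b ⟩
      suc b ∎
    2≤x : 2 ≤ x
    2≤x = +-cancelˡ-≤ a 2 x (begin
      a + 2 ≡⟨ +-comm a 2 ⟩
      suc (suc a) ≤⟨ s≤s a<b ⟩
      suc b ≤⟨ b<a+x ⟩
      a + x ∎)
    x≡2 : x ≡ 2
    x≡2 = ≤-antisym x≤2 2≤x

first-crossing-below : ∀ {n} {P : Pred ℕ p} → Decidable P → (j : Fin n) → ¬ P 0 → P (toℕ j) →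
  Σ (Fin n) λ c → toℕ c < toℕ j × ¬ P (toℕ c) × P (suc (toℕ c))
first-crossing-below {P = P} P? j ¬P0 Pj with first-crossing P? (toℕ j) ¬P0 Pj
... | i , i<j , crossing = c , subst (λ t → t < toℕ j × ¬ P t × P (suc t)) (sym c≡i) (i<j , crossing)
  where
    c : Fin _
    c = fromℕ< (<-trans i<j (toℕ<n j))
    c≡i : toℕ c ≡ i
    c≡i = toℕ-fromℕ< (<-trans i<j (toℕ<n j))

⊖≡+⇒≡+ : ∀ a b c → a ⊖ b ≡ + c → a ≡ b + c
⊖≡+⇒≡+ a       zero    c eq = pos-injective (trans (sym (⊖-≥ z≤n)) eq)
⊖≡+⇒≡+ zero    (suc b) c ()
⊖≡+⇒≡+ (suc a) (suc b) c eq = cong suc (⊖≡+⇒≡+ a b c (trans (sym ([1+m]⊖[1+n]≡m⊖n a b)) eq))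

+⊖≡ : ∀ b c → (b + c) ⊖ b ≡ + c
+⊖≡ b c = begin
  (b + c) ⊖ b        ≡⟨ cong ((b + c) ⊖_) (sym (+-identityʳ b)) ⟩
  (b + c) ⊖ (b + 0)  ≡⟨ +-cancelˡ-⊖ b c 0 ⟩
  c ⊖ 0              ≡⟨ ⊖-≥ z≤n ⟩
  + c                ∎
  where open ≡-Reasoning

gap⇒excess : ∀ {e o m k} → e + o ≡ 2 * m → e ≡ o + 2 * k → e ≡ m + k
gap⇒excess {e} {o} {m} {k} e+o≡2m e≡o+2k = *-cancelˡ-≡ e (m + k) 2 (begin
  2 * e            ≡⟨ cong (λ t → e + t) (+-identityʳ e) ⟩
  e + e            ≡⟨ cong (λ t → e + t) e≡o+2k ⟩
  e + (o + 2 * k)  ≡⟨ sym (+-assoc e o (2 * k)) ⟩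
  e + o + 2 * k    ≡⟨ cong (_+ 2 * k) e+o≡2m ⟩
  2 * m + 2 * k    ≡⟨ sym (*-distribˡ-+ 2 m k) ⟩
  2 * (m + k)      ∎)
  where open ≡-Reasoning

excess⇒gap : ∀ {e o m k} → e + o ≡ 2 * m → e ≡ m + k → e ≡ o + 2 * k
excess⇒gap {e} {o} {m} {k} e+o≡2m e≡m+k = begin
  e                ≡⟨ e≡m+k ⟩
  m + k            ≡⟨ cong (_+ k) (sym k+o≡m) ⟩
  k + o + k        ≡⟨ cong (_+ k) (+-comm k o) ⟩
  o + k + k        ≡⟨ +-assoc o k k ⟩
  o + (k + k)      ≡⟨ cong (λ t → o + (k + t)) (sym (+-identityʳ k)) ⟩
  o + 2 * k        ∎
  where
    open ≡-Reasoning
    k+o≡m : k + o ≡ m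
    k+o≡m = +-cancelˡ-≡ m (k + o) m (begin
      m + (k + o)  ≡⟨ sym (+-assoc m k o) ⟩
      m + k + o    ≡⟨ cong (_+ o) (sym e≡m+k) ⟩
      e + o        ≡⟨ e+o≡2m ⟩
      2 * m        ≡⟨ cong (λ t → m + t) (+-identityʳ m) ⟩
      m + m        ∎)

module _ {n : ℕ} (C : DC n) where

  private
    rows : List (Fin (2 * n))
    rows = allFin (2 * n)

    before? : (m : ℕ) → Decidable (λ r → suc (toℕ (col C r)) ≤ m)
    before? m r = suc (toℕ (col C r)) ≤? m

    even? : Decidable (λ (r : Fin (2 * n)) → suc (toℕ r) ≤ n)
    even? r = suc (toℕ r) ≤? n

    odd? : Decidable (λ (r : Fin (2 * n)) → n ≤ toℕ r)
    odd? r = n ≤? toℕ r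

    inColumn? : (c : Fin n) → Decidable (λ r → col C r ≡ c)
    inColumn? c r = col C r Fin.≟ c

    before-suc : ∀ r c → suc (toℕ (col C r)) ≤ suc (toℕ c) →
      suc (toℕ (col C r)) ≤ toℕ c ⊎ col C r ≡ c
    before-suc r c le with m<1+n⇒m<n∨m≡n le
    ... | inj₁ lt = inj₁ lt
    ... | inj₂ eq = inj₂ (toℕ-injective eq)

    inColumn⇒before-suc : ∀ r c → col C r ≡ c → suc (toℕ (col C r)) ≤ suc (toℕ c)
    inColumn⇒before-suc r c refl = ≤-refl

    before⇒¬inColumn : ∀ r c → suc (toℕ (col C r)) ≤ toℕ c → ¬ col C r ≡ c
    before⇒¬inColumn r c lt refl = <-irrefl refl lt

    dotsBefore : ℕ → ℕ
    dotsBefore m = count (before? m) rows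

    dotsBefore-step : ∀ c → dotsBefore (suc (toℕ c)) ≡ dotsBefore (toℕ c) + 2
    dotsBefore-step c = trans
      (count-split (before? (suc (toℕ c))) (before? (toℕ c)) (inColumn? c)
        (λ r → before-suc r c) (λ r → m≤n⇒m≤1+n) (λ r → inColumn⇒before-suc r c)
        (λ r → before⇒¬inColumn r c) rows)
      (cong (λ t → dotsBefore (toℕ c) + t) (two C c))

    dotsBefore-total : ∀ m → m ≤ n → dotsBefore m ≡ 2 * m
    dotsBefore-total zero    _   = count-none (before? 0) (λ _ ()) rows
    dotsBefore-total (suc m) m<n = begin
      dotsBefore (suc m)       ≡⟨ subst (λ t → dotsBefore (suc t) ≡ dotsBefore t + 2)
                                    (toℕ-fromℕ< m<n) (dotsBefore-step (fromℕ< m<n)) ⟩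
      dotsBefore m + 2         ≡⟨ cong (_+ 2) (dotsBefore-total m (<⇒≤ m<n)) ⟩
      2 * m + 2                ≡⟨ +-comm (2 * m) 2 ⟩
      2 + 2 * m                ≡⟨ sym (*-suc 2 m) ⟩
      2 * suc m                ∎
      where open ≡-Reasoning

  even+odd-before : ∀ m → m ≤ n → nEven C m + nOdd C m ≡ 2 * m
  even+odd-before m m≤n = trans
    (sym (count-split (before? m) (λ r → before? m r ×-dec even? r) (λ r → before? m r ×-dec odd? r)
      (λ r before → ⊎-map (before ,_) (before ,_) (<-≤-connex (toℕ r) n))
      (λ r → proj₁) (λ r → proj₁) (λ r even odd → <⇒≱ (proj₂ even) (proj₂ odd)) rows))
    (dotsBefore-total m m≤n)

  even+odd-column : ∀ c → evenInCol C c + oddInCol C c ≡ 2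
  even+odd-column c = trans
    (sym (count-split (inColumn? c) (λ r → inColumn? c r ×-dec even? r) (λ r → inColumn? c r ×-dec odd? r)
      (λ r inC → ⊎-map (inC ,_) (inC ,_) (<-≤-connex (toℕ r) n))
      (λ r → proj₁) (λ r → proj₁) (λ r even odd → <⇒≱ (proj₂ even) (proj₂ odd)) rows))
    (two C c)

  nEven-step : ∀ c → nEven C (suc (toℕ c)) ≡ nEven C (toℕ c) + evenInCol C c
  nEven-step c = count-split (λ r → before? (suc (toℕ c)) r ×-dec even? r)
    (λ r → before? (toℕ c) r ×-dec even? r) (λ r → inColumn? c r ×-dec even? r)
    (λ r (before , even) → ⊎-map (_, even) (_, even) (before-suc r c before))
    (λ r (before , even) → m≤n⇒m≤1+n before , even)
    (λ r (inC , even) → inColumn⇒before-suc r c inC , even)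
    (λ r (before , _) (inC , _) → before⇒¬inColumn r c before inC) rows

  nEven-zero : nEven C 0 ≡ 0
  nEven-zero = count-none (λ r → before? 0 r ×-dec even? r) (λ _ ()) rows

  -- The dots of rows 1..m are even (m ≤ n) and lie in the first m columns
  -- (a dot never lies right of its row), so e(m) ≥ m.
  nEven-lower : ∀ m → m ≤ n → m ≤ nEven C m
  nEven-lower m m≤n = subst (_≤ nEven C m) (count-below (2 * n) m (≤-trans m≤n (m≤m+n n (n + 0))))
    (count-mono (λ r → before? m r ×-dec even? r) (λ (r : Fin (2 * n)) → suc (toℕ r) ≤? m)
      (λ r r<m → ≤-trans (s≤s (proj₁ (bounds C r))) r<m , ≤-trans r<m m≤n) rows)

  height⇒excess : ∀ {m k} → m ≤ n → heightAfter C m ≡ + (2 * k) → nEven C m ≡ m + k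
  height⇒excess {m} {k} m≤n hm = gap⇒excess {m = m} {k} (even+odd-before m m≤n)
    (⊖≡+⇒≡+ (nEven C m) (nOdd C m) (2 * k) (trans (sym ([+m]-[+n]≡m⊖n (nEven C m) (nOdd C m))) hm))

  excess⇒height : ∀ {m k} → m ≤ n → nEven C m ≡ m + k → heightAfter C m ≡ + (2 * k)
  excess⇒height {m} {k} m≤n em = begin
    + nEven C m -ℤ + nOdd C m       ≡⟨ [+m]-[+n]≡m⊖n (nEven C m) (nOdd C m) ⟩
    nEven C m ⊖ nOdd C m            ≡⟨ cong (_⊖ nOdd C m) (excess⇒gap {m = m} {k} (even+odd-before m m≤n) em) ⟩
    (nOdd C m + 2 * k) ⊖ nOdd C m   ≡⟨ +⊖≡ (nOdd C m) (2 * k) ⟩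
    + (2 * k)                       ∎
    where open ≡-Reasoning

  two-even-at-crossing : ∀ k c → nEven C (toℕ c) < toℕ c + k →
    suc (toℕ c) + k ≤ nEven C (suc (toℕ c)) →
    evenInCol C c ≡ 2 × nEven C (suc (toℕ c)) ≡ suc (toℕ c) + k
  two-even-at-crossing k c below above with
    jump-by-two below (subst (suc (toℕ c) + k ≤_) (nEven-step c) above)
      (subst (evenInCol C c ≤_) (even+odd-column c) (m≤m+n _ _))
  ... | two , reached = two , trans (nEven-step c) reached

lemma5 : (n : ℕ) → 1 ≤ n → (C : DC n) → (j : Fin n) → (k : ℕ) →
    h C j ≡ + (2 * k) →
    oddInCol C j ≡ 2 →
    Σ (Fin n) (λ j′ → (toℕ j′ < toℕ j) × (heightAfter C (suc (toℕ j′)) ≡ + (2 * k)) ×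
      (evenInCol C j′ ≡ 2))
lemma5 n _ C j k hj odd2 =
  let c , c<j , below , above = first-crossing-below (λ m → m + k ≤? nEven C m) j excess-fails-at-0
                                  (≤-reflexive (sym eJ))
      two , reached = two-even-at-crossing C k c (≰⇒> below) above
  in  c , c<j , excess⇒height C (toℕ<n c) reached , two
  where
    J : ℕ
    J = toℕ j
    eJ : nEven C J ≡ J + k
    eJ = height⇒excess C (<⇒≤ (toℕ<n j)) hj
    no-even : evenInCol C j ≡ 0
    no-even = +-cancelʳ-≡ 2 (evenInCol C j) 0
      (trans (cong (λ t → evenInCol C j + t) (sym odd2)) (even+odd-column C j))
    -- e(J + 1) = J + k ≥ J + 1 forces k ≥ 1, while e(0) = 0
    excess-fails-at-0 : ¬ (k ≤ nEven C 0)
    excess-fails-at-0 k≤e0 = <-irrefl refl (begin-strict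
      J                         <⟨ nEven-lower C (suc J) (toℕ<n j) ⟩
      nEven C (suc J)           ≡⟨ nEven-step C j ⟩
      nEven C J + evenInCol C j ≡⟨ cong₂ _+_ eJ no-even ⟩
      J + k + 0                 ≡⟨ +-identityʳ (J + k) ⟩
      J + k                     ≤⟨ +-monoʳ-≤ J k≤e0 ⟩
      J + nEven C 0             ≡⟨ cong (λ t → J + t) (nEven-zero C) ⟩
      J + 0                     ≡⟨ +-identityʳ J ⟩
      J                         ∎)
      where open ≤-Reasoning
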